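{- For any AOGS configuration $F$ and trace $s$: $F\stackrel{s}{\Longrightarrow}_A$ if and only if $F\stackrel{s}{\Longrightarrow}_C$ (with $F$ regarded as a COGS configuration), $s$ is alternating, and $s$ starts with an output action whenever $F$ is active.
   Context: Call-by-value $\lambda$-calculus $\Lambda_V$: values $V ::= x \mid \lambda x.M$, terms $M,N ::= V \mid MN$, evaluation contexts $E ::= [\cdot] \mid VE \mid EM$; reduction $\to_v$ is the least relation with $(\lambda x.M)V \to_v M\{V/x\}$ and $E[M]\to_v E[N]$ whenever $M\to_v N$. Names: variables $x,y,z,\ldots$ and continuation names $p,q,r,\ldots$ (disjoint). An environment $\gamma$ is a finite partial map sending variables to values and continuation names to pairs $(E,q)$; $\cdot$ is union of maps with disjoint domains; $\uplus$ is disjoint union. Alternating OGS (AOGS): configurations are active $\langle M,p,\gamma,\phi\rangle$, passive $\langle\gamma,\phi\rangle$, or initial $\langle M\rangle_\phi$ (treated as passive), $\phi$ a finite set of names. LTS $\to_A$: (P$\tau$) $\langle M,p,\gamma,\phi\rangle\xrightarrow{\tau}_A\langle N,p,\gamma,\phi\rangle$ if $M\to_v N$; (PA) $\langle V,p,\gamma,\phi\rangle\xrightarrow{\overline p(x)}_A\langle\gamma\cdot[x\mapsto V],\phi\uplus\{x\}\rangle$; (PQ) $\langle E[xV],p,\gamma,\phi\rangle\xrightarrow{\overline x(y,q)}_A\langle\gamma\cdot[y\mapsto V]\cdot[q\mapsto(E,p)],\phi\uplus\{y,q\}\rangle$; (OA) $\langle\gamma\cdot[q\mapsto(E,p)],\phi\rangle\xrightarrow{q(x)}_A\langle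 E[x],p,\gamma,\phi\uplus\{x\}\rangle$; (OQ) $\langle\gamma,\phi\rangle\xrightarrow{x(y,p)}_A\langle Vy,p,\gamma,\phi\uplus\{y,p\}\rangle$ if $\gamma(x)=V$; (IOQ) $\langle M\rangle_\phi\xrightarrow{(p)}_A\langle M,p,\emptyset,\phi\uplus\{p\}\rangle$. Concurrent OGS (COGS): a running term $A$ is a finite partial map from continuation names to terms; configurations $\langle A,\gamma,\phi\rangle$ (with disjoint domains of $A$ and $\gamma$) or $\langle M\rangle_\phi$; an AOGS active configuration $\langle M,p,\gamma,\phi\rangle$ is identified with $\langle[p\mapsto M],\gamma,\phi\rangle$ and a passive one $\langle\gamma,\phi\rangle$ with $\langle\emptyset,\gamma,\phi\rangle$. LTS $\to_C$: (P$\tau$) $\langle A\cdot[p\mapsto M],\gamma,\phi\rangle\xrightarrow{\tau}_C\langle A\cdot[p\mapsto N],\gamma,\phi\rangle$ if $M\to_v N$; (PA) $\langle A\cdot[p\mapsto V],\gamma,\phi\rangle\xrightarrow{\overline p(x)}_C\langle A,\gamma\cdot[x\mapsto V],\phi\uplus\{x\}\rangle$; (PQ) $\langle A\cdot[p\mapsto E[xV]],\gamma,\phi\rangle\xrightarrow{\overline x(y,q)}_C\langle A,\gamma\cdot[y\mapsto V]\cdot[q\mapsto(E,p)],\phi\uplus\{y,q\}\rangle$; (OA) $\langle A,\gamma\cdot[p\mapsto(E,q)],\phi\rangle\xrightarrow{p(x)}_C\langle A\cdot[q\mapsto E[x]],\gamma,\phi\uplus\{x\}\rangle$; (OQ) $\langle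 A,\gamma,\phi\rangle\xrightarrow{x(y,p)}_C\langle A\cdot[p\mapsto Vy],\gamma,\phi\uplus\{y,p\}\rangle$ if $\gamma(x)=V$; (IOQ) $\langle M\rangle_\phi\xrightarrow{(p)}_C\langle[p\mapsto M],\emptyset,\phi\uplus\{p\}\rangle$. A trace is a finite sequence $s=\ell_1\cdots\ell_n$ of non-$\tau$ actions; $F\stackrel{s}{\Longrightarrow}$ means $F$ can perform $s$ interleaved with any number of $\tau$ steps (bound names fresh). Output actions ($\overline p(x)$, $\overline x(y,q)$) are Player actions, input actions ($q(x)$, $x(y,p)$, $(p)$) are Opponent actions; a trace is alternating if consecutive actions are never both outputs nor both inputs. -}

module Defs where

open import Data.Nat using (ℕ; zero; suc; _≡ᵇ_)
open import Data.Bool using (Bool; true; false; if_then_else_)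
open import Data.List using (List; []; _∷_; _++_; map; [_])
open import Data.List.Membership.Propositional using (_∈_; _∉_)
open import Data.List.Relation.Unary.Unique.Propositional using (Unique)
open import Data.Product using (_×_; _,_; proj₁)
open import Data.Unit using (⊤)
open import Data.Empty using (⊥)
open import Relation.Binary.PropositionalEquality using (_≡_)

-- Call-by-value λ-calculus, locally nameless representation:
-- bound variables are de Bruijn indices (bvar), free variables are
-- names (fvar x, x : ℕ).  λx.M is represented by lam M (α-equivalence
-- classes are thus represented canonically).

data Term : Set where
  bvar : ℕ → Term
  fvar : ℕ → Term
  lam  : Term → Term
  app  : Term → Term → Term

data Val : Set where
  vvar : ℕ → Val
  vlam : Term → Val

⌜_⌝ : Val → Term
⌜ vvar x ⌝ = fvar x
⌜ vlam M ⌝ = lam M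

data ECtx : Set where
  hole : ECtx
  valE : Val → ECtx → ECtx
  ctxM : ECtx → Term → ECtx

_⟦_⟧ : ECtx → Term → Term
hole ⟦ M ⟧ = M
valE V E ⟦ M ⟧ = app ⌜ V ⌝ (E ⟦ M ⟧)
ctxM E N ⟦ M ⟧ = app (E ⟦ M ⟧) N

-- opening: replace bound index k by u  (M{u/x} for the binder of lam)
openT : ℕ → Term → Term → Term
openT k u (bvar i) = if i ≡ᵇ k then u else bvar i
openT k u (fvar x) = fvar x
openT k u (lam M) = lam (openT (suc k) u M)
openT k u (app M N) = app (openT k u M) (openT k u N)

data _→v_ : Term → Term → Set where
  βv  : ∀ M V → app (lam M) ⌜ V ⌝ →v openT 0 ⌜ V ⌝ M
  ctx : ∀ E {M N} → M →v N → (E ⟦ M ⟧) →v (E ⟦ N ⟧)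

data Name : Set where
  var : ℕ → Name
  con : ℕ → Name

NameSet : Set
NameSet = List Name

-- environments: finite maps  x ↦ V,  q ↦ (E , p)
data Binding : Set where
  vb : ℕ → Val → Binding
  cb : ℕ → ECtx → ℕ → Binding

Env : Set
Env = List Binding

bname : Binding → Name
bname (vb x _)   = var x
bname (cb q _ _) = con q

dom : Env → List Name
dom γ = map bname γ

data Action : Set where
  pa  : ℕ → ℕ → Action        -- p̄(x)      : pa p x
  pq  : ℕ → ℕ → ℕ → Action    -- x̄(y,q)    : pq x y q
  oa  : ℕ → ℕ → Action        -- q(x)       : oa q x
  oq  : ℕ → ℕ → ℕ → Action    -- x(y,p)     : oq x y p
  ioq : ℕ → Action            -- (p)        : ioq p

data Label : Set where
  τ   : Label
  act : Action → Label

isOutput : Action → Bool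
isOutput (pa _ _)   = true
isOutput (pq _ _ _) = true
isOutput (oa _ _)   = false
isOutput (oq _ _ _) = false
isOutput (ioq _)    = false

IsOutput : Action → Set
IsOutput a = isOutput a ≡ true

data Alternating : List Action → Set where
  alt[]  : Alternating []
  alt[-] : ∀ a → Alternating [ a ]
  alt∷   : ∀ {a b s} → (isOutput a ≡ isOutput b → ⊥) → Alternating (b ∷ s) →
           Alternating (a ∷ b ∷ s)

OutputFirst : List Action → Set
OutputFirst []      = ⊤
OutputFirst (a ∷ _) = IsOutput a

data AConf : Set where
  active  : Term → ℕ → Env → NameSet → AConf
  passive : Env → NameSet → AConf
  initial : Term → NameSet → AConf

IsActive : AConf → Set
IsActive (active _ _ _ _) = ⊤
IsActive (passive _ _)    = ⊥
IsActive (initial _ _)    = ⊥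

-- a configuration really consists of finite maps
WfA : AConf → Set
WfA (active M p γ φ) = Unique (dom γ) × (con p ∉ dom γ)
WfA (passive γ φ)    = Unique (dom γ)
WfA (initial M φ)    = ⊤

-- freshness of a newly introduced name (disjoint unions φ ⊎ {n}, γ · [n ↦ _])
FreshA : Name → Env → NameSet → Set
FreshA n γ φ = (n ∉ φ) × (n ∉ dom γ)

data _—[_]→A_ : AConf → Label → AConf → Set where
  Pτ  : ∀ {M N p γ φ} → M →v N →
        active M p γ φ —[ τ ]→A active N p γ φ
  PA  : ∀ {M V p x γ φ} → M ≡ ⌜ V ⌝ → FreshA (var x) γ φ →
        active M p γ φ —[ act (pa p x) ]→A passive (vb x V ∷ γ) (var x ∷ φ)
  PQ  : ∀ {M E x V p y q γ φ} → M ≡ E ⟦ app (fvar x) ⌜ V ⌝ ⟧ →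
        FreshA (var y) γ φ → FreshA (con q) γ φ →
        active M p γ φ —[ act (pq x y q) ]→A
          passive (cb q E p ∷ vb y V ∷ γ) (con q ∷ var y ∷ φ)
  OA  : ∀ {γ₀ γ₁ γ₂ q E p x φ} → γ₀ ≡ γ₁ ++ cb q E p ∷ γ₂ →
        FreshA (var x) (γ₁ ++ γ₂) φ →
        passive γ₀ φ —[ act (oa q x) ]→A active (E ⟦ fvar x ⟧) p (γ₁ ++ γ₂) (var x ∷ φ)
  OQ  : ∀ {γ x V y p φ} → vb x V ∈ γ → FreshA (var y) γ φ → FreshA (con p) γ φ →
        passive γ φ —[ act (oq x y p) ]→A active (app ⌜ V ⌝ (fvar y)) p γ (con p ∷ var y ∷ φ)
  IOQ : ∀ {M p φ} → con p ∉ φ →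
        initial M φ —[ act (ioq p) ]→A active M p [] (con p ∷ φ)

data _⟹A_ : AConf → List Action → Set where
  done : ∀ {F} → F ⟹A []
  tau  : ∀ {F G s} → F —[ τ ]→A G → G ⟹A s → F ⟹A s
  step : ∀ {F G a s} → F —[ act a ]→A G → G ⟹A s → F ⟹A (a ∷ s)

RTerm : Set
RTerm = List (ℕ × Term)    -- running term: finite map p ↦ M

domR : RTerm → List Name
domR A = map (λ b → con (proj₁ b)) A

data CConf : Set where
  conf  : RTerm → Env → NameSet → CConf
  cinit : Term → NameSet → CConf

FreshC : Name → RTerm → Env → NameSet → Set
FreshC n A γ φ = (n ∉ φ) × (n ∉ dom γ) × (n ∉ domR A)

data _—[_]→C_ : CConf → Label → CConf → Set where
  Pτ  : ∀ {A₀ A₁ A₂ p M N γ φ} → A₀ ≡ A₁ ++ (p , M) ∷ A₂ → M →v N →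
        conf A₀ γ φ —[ τ ]→C conf (A₁ ++ (p , N) ∷ A₂) γ φ
  PA  : ∀ {A₀ A₁ A₂ p M V x γ φ} → A₀ ≡ A₁ ++ (p , M) ∷ A₂ → M ≡ ⌜ V ⌝ →
        FreshC (var x) (A₁ ++ A₂) γ φ →
        conf A₀ γ φ —[ act (pa p x) ]→C conf (A₁ ++ A₂) (vb x V ∷ γ) (var x ∷ φ)
  PQ  : ∀ {A₀ A₁ A₂ p M E x V y q γ φ} → A₀ ≡ A₁ ++ (p , M) ∷ A₂ →
        M ≡ E ⟦ app (fvar x) ⌜ V ⌝ ⟧ →
        FreshC (var y) (A₁ ++ A₂) γ φ → FreshC (con q) (A₁ ++ A₂) γ φ →
        conf A₀ γ φ —[ act (pq x y q) ]→C
          conf (A₁ ++ A₂) (cb q E p ∷ vb y V ∷ γ) (con q ∷ var y ∷ φ)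
  OA  : ∀ {A γ₀ γ₁ γ₂ p E q x φ} → γ₀ ≡ γ₁ ++ cb p E q ∷ γ₂ →
        FreshC (var x) A (γ₁ ++ γ₂) φ → con q ∉ domR A →
        conf A γ₀ φ —[ act (oa p x) ]→C conf ((q , E ⟦ fvar x ⟧) ∷ A) (γ₁ ++ γ₂) (var x ∷ φ)
  OQ  : ∀ {A γ x V y p φ} → vb x V ∈ γ → FreshC (var y) A γ φ → FreshC (con p) A γ φ →
        conf A γ φ —[ act (oq x y p) ]→C
          conf ((p , app ⌜ V ⌝ (fvar y)) ∷ A) γ (con p ∷ var y ∷ φ)
  IOQ : ∀ {M p φ} → con p ∉ φ →
        cinit M φ —[ act (ioq p) ]→C conf [ (p , M) ] [] (con p ∷ φ)

data _⟹C_ : CConf → List Action → Set where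
  done : ∀ {F} → F ⟹C []
  tau  : ∀ {F G s} → F —[ τ ]→C G → G ⟹C s → F ⟹C s
  step : ∀ {F G a s} → F —[ act a ]→C G → G ⟹C s → F ⟹C (a ∷ s)

toC : AConf → CConf
toC (active M p γ φ) = conf [ (p , M) ] γ φ
toC (passive γ φ)    = conf [] γ φ
toC (initial M φ)    = cinit M φ

-- An AOGS configuration is a COGS configuration with at most one running
-- thread, and every AOGS rule is the COGS rule acting on that thread, so the
-- two systems simulate each other step for step as long as the COGS run keeps
-- at most one thread.  Player moves consume the running thread and Opponent
-- moves create one, so AOGS traces alternate and open with Player exactly from
-- active configurations; conversely, under these two conditions a COGS run
-- from a single-thread configuration never meets a second thread.
module Submission where

open import Defs
open import Data.Bool using (Bool; true; false; not)
open import Data.Bool.Properties using (not-¬; ¬-not)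
open import Data.Empty using (⊥-elim)
open import Data.List using (List; []; _∷_; _++_; [_])
open import Data.List.Properties using (∷-injectiveʳ; ++-conicalʳ)
open import Data.Product using (Σ; _×_; _,_)
open import Data.Unit using (⊤; tt)
open import Function.Bundles using (_⇔_; mk⇔)
open import Relation.Binary.PropositionalEquality using (_≡_; _≢_; refl; sym; trans; subst)

isActive : AConf → Bool
isActive (active _ _ _ _) = true
isActive (passive _ _)    = false
isActive (initial _ _)    = false

StartsWith : Bool → List Action → Set
StartsWith b []      = ⊤
StartsWith b (a ∷ _) = isOutput a ≡ b

StartsWith-true⇒OutputFirst : ∀ {s} → StartsWith true s → OutputFirst s
StartsWith-true⇒OutputFirst {[]}    _ = tt
StartsWith-true⇒OutputFirst {_ ∷ _} e = e

alternating-∷ : ∀ {a b s} → isOutput a ≡ b → StartsWith (not b) s →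
                Alternating s → Alternating (a ∷ s)
alternating-∷ {a} {s = []}    _  _  _  = alt[-] a
alternating-∷ {s = _ ∷ _} ea ec al = alt∷ (λ e → not-¬ refl (trans (sym ea) (trans e ec))) al

alternating-tail : ∀ {a s} → Alternating (a ∷ s) → Alternating s
alternating-tail (alt[-] _)  = alt[]
alternating-tail (alt∷ _ al) = al

alternating-next : ∀ {a s} → Alternating (a ∷ s) → StartsWith (not (isOutput a)) s
alternating-next (alt[-] _)   = tt
alternating-next (alt∷ a≢b _) = ¬-not (λ e → a≢b (sym e))

alternating-after-input : ∀ {a s} → Alternating (a ∷ s) → isOutput a ≡ false → OutputFirst s
alternating-after-input {s = s} al e =
  StartsWith-true⇒OutputFirst (subst (λ b → StartsWith (not b) s) e (alternating-next al))

visible-step-polarity : ∀ {F G a} → F —[ act a ]→A G →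
                        isOutput a ≡ isActive F × isActive G ≡ not (isActive F)
visible-step-polarity (PA _ _)    = refl , refl
visible-step-polarity (PQ _ _ _)  = refl , refl
visible-step-polarity (OA _ _)    = refl , refl
visible-step-polarity (OQ _ _ _)  = refl , refl
visible-step-polarity (IOQ _)     = refl , refl

τ-step-isActive : ∀ {F G} → F —[ τ ]→A G → isActive G ≡ isActive F
τ-step-isActive (Pτ _) = refl

τ-step-source-active : ∀ {F G} → F —[ τ ]→A G → IsActive F
τ-step-source-active (Pτ _) = tt

active-after-input : ∀ {F G a} → F —[ act a ]→A G → IsActive G → isOutput a ≡ false
active-after-input (OA _ _)   _ = refl
active-after-input (OQ _ _ _) _ = refl
active-after-input (IOQ _)    _ = refl

trace-alternates : ∀ {F s} → F ⟹A s → Alternating s × StartsWith (isActive F) s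
trace-alternates done = alt[] , tt
trace-alternates {s = s} (tau t d) =
  let al , st = trace-alternates d
  in al , subst (λ b → StartsWith b s) (τ-step-isActive t) st
trace-alternates (step t d) =
  let al , st = trace-alternates d
      ea , eG = visible-step-polarity t
  in alternating-∷ ea (subst (λ b → StartsWith b _) eG st) al , ea

FreshA⇒FreshC[] : ∀ {n γ φ} → FreshA n γ φ → FreshC n [] γ φ
FreshA⇒FreshC[] (n∉φ , n∉γ) = n∉φ , n∉γ , λ ()

FreshC⇒FreshA : ∀ {n A γ φ} → FreshC n A γ φ → FreshA n γ φ
FreshC⇒FreshA (n∉φ , n∉γ , _) = n∉φ , n∉γ

toC-step : ∀ {F G l} → F —[ l ]→A G → toC F —[ l ]→C toC G
toC-step (Pτ r)        = Pτ {A₁ = []} {A₂ = []} refl r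
toC-step (PA e fx)     = PA {A₁ = []} {A₂ = []} refl e (FreshA⇒FreshC[] fx)
toC-step (PQ e fy fq)  = PQ {A₁ = []} {A₂ = []} refl e (FreshA⇒FreshC[] fy) (FreshA⇒FreshC[] fq)
toC-step (OA e fx)     = OA e (FreshA⇒FreshC[] fx) (λ ())
toC-step (OQ m fy fp)  = OQ m (FreshA⇒FreshC[] fy) (FreshA⇒FreshC[] fp)
toC-step (IOQ p∉φ)     = IOQ p∉φ

toC-trace : ∀ {F s} → F ⟹A s → toC F ⟹C s
toC-trace done       = done
toC-trace (tau t d)  = tau (toC-step t) (toC-trace d)
toC-trace (step t d) = step (toC-step t) (toC-trace d)

[]≢++∷ : ∀ {A : Set} {y : A} xs ys → [] ≢ xs ++ y ∷ ys
[]≢++∷ xs ys eq with ++-conicalʳ xs _ (sym eq)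
... | ()

singleton-focus : ∀ {A : Set} {x y : A} xs ys → [ x ] ≡ xs ++ y ∷ ys →
                  xs ≡ [] × x ≡ y × ys ≡ []
singleton-focus []       []      refl = refl , refl , refl
singleton-focus (_ ∷ xs) ys      eq   = ⊥-elim ([]≢++∷ xs ys (∷-injectiveʳ eq))

toC-τ-reflect : ∀ {F G′} → toC F —[ τ ]→C G′ → Σ AConf λ G → F —[ τ ]→A G × toC G ≡ G′
toC-τ-reflect {active _ _ _ _} (Pτ {A₁ = A₁} {A₂ = A₂} eq r) with singleton-focus A₁ A₂ eq
... | refl , refl , refl = _ , Pτ r , refl
toC-τ-reflect {passive _ _} (Pτ {A₁ = A₁} {A₂ = A₂} eq _) = ⊥-elim ([]≢++∷ A₁ A₂ eq)

-- The side condition excludes Opponent moves, which COGS also allows from an active configuration.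
toC-step-reflect : ∀ {F G′ a} → toC F —[ act a ]→C G′ → (IsActive F → IsOutput a) →
                   Σ AConf λ G → F —[ act a ]→A G × toC G ≡ G′
toC-step-reflect {active _ _ _ _} (PA {A₁ = A₁} {A₂ = A₂} eq e fx) _ with singleton-focus A₁ A₂ eq
... | refl , refl , refl = _ , PA e (FreshC⇒FreshA fx) , refl
toC-step-reflect {active _ _ _ _} (PQ {A₁ = A₁} {A₂ = A₂} eq e fy fq) _ with singleton-focus A₁ A₂ eq
... | refl , refl , refl = _ , PQ e (FreshC⇒FreshA fy) (FreshC⇒FreshA fq) , refl
toC-step-reflect {active _ _ _ _} (OA _ _ _) output with output tt
... | ()
toC-step-reflect {active _ _ _ _} (OQ _ _ _) output with output tt
... | ()
toC-step-reflect {passive _ _} (PA {A₁ = A₁} {A₂ = A₂} eq _ _) _     = ⊥-elim ([]≢++∷ A₁ A₂ eq)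
toC-step-reflect {passive _ _} (PQ {A₁ = A₁} {A₂ = A₂} eq _ _ _) _   = ⊥-elim ([]≢++∷ A₁ A₂ eq)
toC-step-reflect {passive _ _} (OA e fx _) _    = _ , OA e (FreshC⇒FreshA fx) , refl
toC-step-reflect {passive _ _} (OQ m fy fp) _   = _ , OQ m (FreshC⇒FreshA fy) (FreshC⇒FreshA fp) , refl
toC-step-reflect {initial _ _} (IOQ p∉φ) _      = _ , IOQ p∉φ , refl

toC-trace-reflect : ∀ {F s} → toC F ⟹C s → Alternating s → (IsActive F → OutputFirst s) → F ⟹A s
toC-trace-reflect done _ _ = done
toC-trace-reflect (tau t d) al output with toC-τ-reflect t
... | _ , t′ , refl = tau t′ (toC-trace-reflect d al (λ _ → output (τ-step-source-active t′)))
toC-trace-reflect (step t d) al output with toC-step-reflect t output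
... | _ , t′ , refl =
  step t′ (toC-trace-reflect d (alternating-tail al)
                               (λ G-active → alternating-after-input al (active-after-input t′ G-active)))

active-StartsWith⇒OutputFirst : ∀ F {s} → IsActive F → StartsWith (isActive F) s → OutputFirst s
active-StartsWith⇒OutputFirst (active _ _ _ _) _ = StartsWith-true⇒OutputFirst

lemma7p20 : (F : AConf) (s : List Action) → WfA F →
    (F ⟹A s) ⇔ ((toC F ⟹C s) × Alternating s × (IsActive F → OutputFirst s))
lemma7p20 F s _ = mk⇔ forward backward
  where
  forward : F ⟹A s → (toC F ⟹C s) × Alternating s × (IsActive F → OutputFirst s)
  forward d = let al , st = trace-alternates d
              in toC-trace d , al , λ F-active → active-StartsWith⇒OutputFirst F F-active st

  backward : (toC F ⟹C s) × Alternating s × (IsActive F → OutputFirst s) → F ⟹A s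
  backward (c , al , output) = toC-trace-reflect c al output
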